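{- For every $n,r$ with $r\le n$, there exists an $n$-vertex directed graph $G$ and a set $S$ of $r$ vertices such that any 2-fault-tolerant reachability subgraph of $G$ for the pair set $S\times S$ has $\Omega(rn)$ edges.
   Context: A subgraph $H$ of $G=(V,E)$ is a $k$-fault-tolerant reachability subgraph of $G$ for $\mathcal{P}\subseteq V\times V$ if for every $(s,t)\in\mathcal{P}$ and every $F\subseteq E$ with $|F|\le k$, $t$ is reachable from $s$ in $G\setminus F$ iff $t$ is reachable from $s$ in $H\setminus F$. -}

module Defs where

open import Data.Nat using (ℕ; _+_; _≤_)
open import Data.Bool using (Bool; true; false)
open import Data.Fin using (Fin)
open import Data.List using (List; allFin; map; length)
open import Data.Nat.ListAction using (sum)
open import Data.List.Relation.Unary.All using (All)
import Data.List.Membership.Propositional as L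
open import Data.Product using (_×_; _,_)
open import Data.Fin.Subset using (Subset; _∈_)
open import Relation.Nullary using (¬_)
open import Relation.Binary.PropositionalEquality using (_≡_)
open import Relation.Binary.Construct.Closure.ReflexiveTransitive using (Star)

Digraph : ℕ → Set
Digraph n = Fin n → Fin n → Bool

Edge : ∀ {n} → Digraph n → Fin n → Fin n → Set
Edge G u v = G u v ≡ true

Subgraph : ∀ {n} → Digraph n → Digraph n → Set
Subgraph H G = ∀ u v → Edge H u v → Edge G u v

bit : Bool → ℕ
bit true  = 1
bit false = 0

edgeCount : ∀ {n} → Digraph n → ℕ
edgeCount {n} G = sum (map (λ u → sum (map (λ v → bit (G u v)) (allFin n))) (allFin n))

EdgeMinus : ∀ {n} → Digraph n → List (Fin n × Fin n) → Fin n → Fin n → Set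
EdgeMinus G F u v = Edge G u v × ¬ ((u , v) L.∈ F)

Reach : ∀ {n} → Digraph n → List (Fin n × Fin n) → Fin n → Fin n → Set
Reach G F s t = Star (EdgeMinus G F) s t

FaultSet : ∀ {n} → ℕ → Digraph n → List (Fin n × Fin n) → Set
FaultSet k G F = length F ≤ k × All (λ e → Edge G (Data.Product.proj₁ e) (Data.Product.proj₂ e)) F

FTRS : ∀ {n} → ℕ → Digraph n → Subset n → Digraph n → Set
FTRS k G S H =
  Subgraph H G ×
  (∀ s t → s ∈ S → t ∈ S → ∀ F → FaultSet k G F →
     (Reach G F s t → Reach H F s t) × (Reach H F s t → Reach G F s t))

-- The graph is a grid of β rows and 2h columns. The h left columns are
-- directed downwards, the h right columns upwards, and the left vertex in
-- row p has a "cross" arc to every right vertex in row β − 1 − p; the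
-- sources S contain the top row. A cross arc u → v from column x to
-- column y is critical: after failing the two vertical arcs out of u and
-- into v, the only path from the top of column x to the top of column y
-- goes down to u, across, and up from v. Hence every 2-fault-tolerant
-- reachability subgraph keeps all β h² cross arcs, and choosing h ≈ r/2,
-- β ≈ n/r gives r n ≤ 12 β h².
module Submission where

open import Defs
open import Data.Nat using (ℕ; zero; suc; _+_; _*_; _∸_; _≤_; _<_; z≤n; s≤s; s≤s⁻¹; NonZero)
open import Data.Nat.Properties
open import Data.Nat.DivMod
open import Data.Nat.Divisibility using (divides)
open import Data.Nat.ListAction using (sum)
open import Data.Nat.Tactic.RingSolver using (solve-∀)
open import Data.Bool using (Bool; true; false)
import Data.Bool.Properties as Bool
open import Data.Product using (Σ; ∃-syntax; _×_; _,_; proj₁; proj₂)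
open import Data.Sum using (_⊎_; inj₁; inj₂)
open import Data.Empty using (⊥-elim)
open import Data.Fin using (Fin; toℕ; fromℕ<)
open import Data.Fin.Properties using (toℕ-injective; toℕ-fromℕ<; fromℕ<-toℕ; toℕ<n)
open import Data.Fin.Subset using (Subset; ⊥; ∣_∣; _∈_; inside)
open import Data.Fin.Subset.Properties using (∣⊥∣≡0)
open import Data.Vec using (_∷_; []; here; there)
open import Data.List using (List; []; _∷_; _++_; length; map; allFin; tabulate; filter)
open import Data.List.Properties using (length-++; length-filter; map-tabulate)
open import Data.List.Membership.Propositional.Properties using (∈-++⁻; ∈-++⁺ˡ; ∈-++⁺ʳ; ∈-filter⁺; ∈-filter⁻)
open import Data.List.Relation.Unary.Any using (here)
open import Data.List.Relation.Unary.All using (All)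
open import Data.List.Relation.Unary.All.Properties using (all-filter; ++⁺)
import Data.List.Membership.Propositional as List
open import Function using (_∘_; id)
open import Relation.Nullary using (¬_; Dec; yes; no; does)
open import Relation.Nullary.Decidable using (dec-true; _×-dec_; _⊎-dec_)
open import Relation.Binary using (Rel)
open import Relation.Binary.PropositionalEquality
open import Relation.Binary.Construct.Closure.ReflexiveTransitive using (Star; ε; _◅_; _◅◅_)
open import Relation.Unary using (Pred)
open import Level using (0ℓ)

does-true⇒ : ∀ {P : Set} (P? : Dec P) → does P? ≡ true → P
does-true⇒ (yes p) _ = p

∑< : ℕ → (ℕ → ℕ) → ℕ
∑< zero    f = 0
∑< (suc n) f = f 0 + ∑< n (f ∘ suc)

syntax ∑< n (λ i → e) = ∑[ i < n ] e

∑-cong : ∀ n {f g : ℕ → ℕ} → (∀ i → f i ≡ g i) → ∑< n f ≡ ∑< n g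
∑-cong zero    f≡g = refl
∑-cong (suc n) f≡g = cong₂ _+_ (f≡g 0) (∑-cong n (f≡g ∘ suc))

∑-mono : ∀ n {f g : ℕ → ℕ} → (∀ i → i < n → f i ≤ g i) → ∑< n f ≤ ∑< n g
∑-mono zero    f≤g = z≤n
∑-mono (suc n) f≤g = +-mono-≤ (f≤g 0 (s≤s z≤n)) (∑-mono n (λ i i<n → f≤g (suc i) (s≤s i<n)))

∑-const : ∀ n c → ∑[ i < n ] c ≡ n * c
∑-const zero    c = refl
∑-const (suc n) c = cong (c +_) (∑-const n c)

∑-+ : ∀ m n f → ∑< (m + n) f ≡ ∑< m f + ∑[ i < n ] f (m + i)
∑-+ zero    n f = refl
∑-+ (suc m) n f = trans (cong (f 0 +_) (∑-+ m n (f ∘ suc))) (sym (+-assoc (f 0) _ _))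

∑-suffix : ∀ m n f → ∑[ i < n ] f (m + i) ≤ ∑< (m + n) f
∑-suffix m n f = subst (∑[ i < n ] f (m + i) ≤_) (sym (∑-+ m n f)) (m≤n+m _ (∑< m f))

∑-monoˡ : ∀ {m n} f → m ≤ n → ∑< m f ≤ ∑< n f
∑-monoˡ {m} {n} f m≤n =
  subst (_ ≤_) (trans (sym (∑-+ m (n ∸ m) f)) (cong (λ k → ∑< k f) (m+[n∸m]≡n m≤n))) (m≤m+n _ _)

∑-term : ∀ {i n} f → i < n → f i ≤ ∑< n f
∑-term {zero}  {suc n} f _         = m≤m+n _ _
∑-term {suc i} {suc n} f (s≤s i<n) = ≤-trans (∑-term (f ∘ suc) i<n) (m≤n+m _ _)

∑-blocks : ∀ N β f → ∑< (β * N) f ≡ ∑[ e < β ] ∑[ z < N ] f (z + e * N)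
∑-blocks N zero    f = refl
∑-blocks N (suc β) f = begin
  ∑< (N + β * N) f
    ≡⟨ ∑-+ N (β * N) f ⟩
  ∑< N f + ∑[ i < β * N ] f (N + i)
    ≡⟨ cong₂ _+_ (∑-cong N (cong f ∘ sym ∘ +-identityʳ)) (∑-blocks N β (f ∘ (N +_))) ⟩
  ∑[ z < N ] f (z + 0) + ∑[ e < β ] ∑[ z < N ] f (N + (z + e * N))
    ≡⟨ cong (_ +_) (∑-cong β (λ e → ∑-cong N (λ z → cong f (next-block z e)))) ⟩
  ∑[ e < suc β ] ∑[ z < N ] f (z + e * N) ∎
  where
  open ≡-Reasoning
  next-block : ∀ z e → N + (z + e * N) ≡ z + suc e * N
  next-block z e = trans (sym (+-assoc N z (e * N))) (trans (cong (_+ e * N) (+-comm N z)) (+-assoc z N (e * N)))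

∑-block : ∀ {N β n e} f → e < β → β * N ≤ n → ∑[ z < N ] f (z + e * N) ≤ ∑< n f
∑-block {N} {β} f e<β βN≤n =
  ≤-trans (∑-term (λ e → ∑[ z < N ] f (z + e * N)) e<β)
          (subst (_≤ _) (∑-blocks N β f) (∑-monoˡ f βN≤n))

sum-allFin : ∀ n (f : ℕ → ℕ) → sum (map (f ∘ toℕ) (allFin n)) ≡ ∑< n f
sum-allFin n f = trans (cong sum (map-tabulate {n = n} id (f ∘ toℕ))) (sum-tabulate n f)
  where
  sum-tabulate : ∀ n (f : ℕ → ℕ) → sum (tabulate {n = n} (f ∘ toℕ)) ≡ ∑< n f
  sum-tabulate zero    f = refl
  sum-tabulate (suc n) f = cong (f 0 +_) (sum-tabulate n (f ∘ suc))

edgeCount-toℕ : ∀ {n} (g : ℕ → ℕ → Bool) →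
                edgeCount {n} (λ u v → g (toℕ u) (toℕ v)) ≡ ∑[ i < n ] ∑[ j < n ] bit (g i j)
edgeCount-toℕ {n} g = trans (sum-allFin n _) (∑-cong n (λ i → sum-allFin n (bit ∘ g i)))

sum-map-mono : ∀ {A : Set} {f g : A → ℕ} → (∀ a → f a ≤ g a) → ∀ xs → sum (map f xs) ≤ sum (map g xs)
sum-map-mono f≤g []       = z≤n
sum-map-mono f≤g (x ∷ xs) = +-mono-≤ (f≤g x) (sum-map-mono f≤g xs)

bit-mono : ∀ {b c} → (b ≡ true → c ≡ true) → bit b ≤ bit c
bit-mono {false} _   = z≤n
bit-mono {true}  b⇒c = ≤-reflexive (cong bit (sym (b⇒c refl)))

edgeCount-mono : ∀ {n} {H G : Digraph n} → Subgraph H G → edgeCount H ≤ edgeCount G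
edgeCount-mono {n} H⊆G =
  sum-map-mono (λ u → sum-map-mono (λ v → bit-mono (H⊆G u v)) (allFin n)) (allFin n)

Star-escape : ∀ {A : Set} {T : Rel A 0ℓ} {P : Pred A 0ℓ} {Q : Set} →
         (∀ {a b} → T a b → P a → P b ⊎ Q) → ∀ {a b} → Star T a b → P a → ¬ P b → Q
Star-escape step ε        Pa ¬Pb = ⊥-elim (¬Pb Pa)
Star-escape step (t ◅ ts) Pa ¬Pb with step t Pa
... | inj₁ Pb = Star-escape step ts Pb ¬Pb
... | inj₂ q  = q

Star-lift : ∀ {n} {R : Rel ℕ 0ℓ} {T : Rel (Fin n) 0ℓ} →
            (∀ {s j} → R (toℕ s) j → Σ (Fin n) λ t → toℕ t ≡ j × T s t) →
            ∀ {s j} → Star R (toℕ s) j → Σ (Fin n) λ t → toℕ t ≡ j × Star T s t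
Star-lift lift {s} ε = s , refl , ε
Star-lift lift (r ◅ rs) with lift r
... | t , refl , tr with Star-lift lift rs
...   | t′ , eq , trs = t′ , eq , tr ◅ trs

pairAt : ∀ {n} → ℕ → ℕ → List (Fin n × Fin n)
pairAt {n} i j with i <? n | j <? n
... | yes i<n | yes j<n = (fromℕ< i<n , fromℕ< j<n) ∷ []
... | _       | _       = []

length-pairAt : ∀ {n} i j → length (pairAt {n} i j) ≤ 1
length-pairAt {n} i j with i <? n | j <? n
... | yes _ | yes _ = ≤-refl
... | yes _ | no _  = z≤n
... | no _  | _     = z≤n

∈-pairAt⁻ : ∀ {n i j} {s t : Fin n} → (s , t) List.∈ pairAt i j → toℕ s ≡ i × toℕ t ≡ j
∈-pairAt⁻ {n} {i} {j} m with i <? n | j <? n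
∈-pairAt⁻ (here refl) | yes _ | yes _ = toℕ-fromℕ< _ , toℕ-fromℕ< _

∈-pairAt⁺ : ∀ {n} {s t : Fin n} → (s , t) List.∈ pairAt (toℕ s) (toℕ t)
∈-pairAt⁺ {n} {s} {t} with toℕ s <? n | toℕ t <? n
... | yes s<n | yes t<n = here (cong₂ _,_ (sym (fromℕ<-toℕ s s<n)) (sym (fromℕ<-toℕ t t<n)))
... | yes _   | no t≮n  = ⊥-elim (t≮n (toℕ<n t))
... | no s≮n  | _       = ⊥-elim (s≮n (toℕ<n s))

module _ {n} (G : Digraph n) where

  present? : (e : Fin n × Fin n) → Dec (Edge G (proj₁ e) (proj₂ e))
  present? (s , t) = G s t Bool.≟ true

  edgeAt : ℕ → ℕ → List (Fin n × Fin n)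
  edgeAt i j = filter present? (pairAt i j)

  length-edgeAt : ∀ i j → length (edgeAt i j) ≤ 1
  length-edgeAt i j = ≤-trans (length-filter present? (pairAt i j)) (length-pairAt {n} i j)

  edgeAt-edges : ∀ i j → All (λ e → Edge G (proj₁ e) (proj₂ e)) (edgeAt i j)
  edgeAt-edges i j = all-filter _ (pairAt i j)

  ∈-edgeAt⁻ : ∀ {i j s t} → (s , t) List.∈ edgeAt i j → toℕ s ≡ i × toℕ t ≡ j
  ∈-edgeAt⁻ m = ∈-pairAt⁻ (proj₁ (∈-filter⁻ _ m))

  ∈-edgeAt⁺ : ∀ {s t} → Edge G s t → (s , t) List.∈ edgeAt (toℕ s) (toℕ t)
  ∈-edgeAt⁺ e = ∈-filter⁺ _ ∈-pairAt⁺ e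

module Grid (N : ℕ) .{{_ : NonZero N}} where

  col row : ℕ → ℕ
  col i = i % N
  row i = i / N

  col<N : ∀ i → col i < N
  col<N i = m%n<n i N

  row< : ∀ {i β} → i < β * N → row i < β
  row< = m<n*o⇒m/o<n

  col-small : ∀ {z} → z < N → col z ≡ z
  col-small = m<n⇒m%n≡m

  row-small : ∀ {z} → z < N → row z ≡ 0
  row-small = m<n⇒m/n≡0

  col-cell : ∀ {z} e → z < N → col (z + e * N) ≡ z
  col-cell {z} e z<N = trans ([m+kn]%n≡m%n z e N) (col-small z<N)

  row-cell : ∀ {z} e → z < N → row (z + e * N) ≡ e
  row-cell {z} e z<N = trans (+-distrib-/-∣ʳ z (divides e refl)) (cong₂ _+_ (row-small z<N) (m*n/n≡m e N))

  col-+N : ∀ i → col (i + N) ≡ col i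
  col-+N i = [m+n]%n≡m%n i N

  row-+N : ∀ i → row (i + N) ≡ suc (row i)
  row-+N i = trans (+-distrib-/-∣ʳ i (divides 1 (sym (+-identityʳ N))))
                   (trans (cong (row i +_) (n/n≡1 N)) (+-comm (row i) 1))

  cell-injective : ∀ {i j} → col i ≡ col j → row i ≡ row j → i ≡ j
  cell-injective {i} {j} c r =
    trans (m≡m%n+[m/n]*n i N) (trans (cong₂ (λ a b → a + b * N) c r) (sym (m≡m%n+[m/n]*n j N)))

  cell< : ∀ {z e β} → z < N → e < β → z + e * N < β * N
  cell< {z} {e} z<N e<β = ≤-trans (+-monoˡ-< (e * N) z<N) (*-monoˡ-≤ N e<β)

  cell-suc : ∀ z e → z + suc e * N ≡ (z + e * N) + N
  cell-suc z e = trans (cong (z +_) (+-comm N (e * N))) (sym (+-assoc z (e * N) N))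

module Construction (k β : ℕ) where

  h N : ℕ
  h = suc k
  N = h + h

  open Grid N public

  -- Vertex i < β N sits in row i / N and column i % N; larger vertices are isolated.
  InGrid : Pred ℕ 0ℓ
  InGrid i = i < β * N

  Down Up Cross Arc : Rel ℕ 0ℓ
  Down  i j = InGrid i × InGrid j × col i < h × j ≡ i + N
  Up    i j = InGrid i × InGrid j × h ≤ col i × i ≡ j + N
  Cross i j = InGrid i × InGrid j × col i < h × h ≤ col j × suc (row i + row j) ≡ β
  Arc   i j = Down i j ⊎ Up i j ⊎ Cross i j

  Cross? : ∀ i j → Dec (Cross i j)
  Cross? i j = (i <? β * N) ×-dec (j <? β * N) ×-dec (col i <? h) ×-dec (h ≤? col j) ×-dec (suc (row i + row j) ≟ β)

  Arc? : ∀ i j → Dec (Arc i j)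
  Arc? i j = ((i <? β * N) ×-dec (j <? β * N) ×-dec (col i <? h) ×-dec (j ≟ i + N))
        ⊎-dec ((i <? β * N) ×-dec (j <? β * N) ×-dec (h ≤? col i) ×-dec (i ≟ j + N))
        ⊎-dec Cross? i j

  arcs crossArcs : ∀ {n} → Digraph n
  arcs      u v = does (Arc? (toℕ u) (toℕ v))
  crossArcs u v = does (Cross? (toℕ u) (toℕ v))

  arc-target : ∀ {i j} → Arc i j → InGrid j
  arc-target (inj₁ (_ , j∈ , _))        = j∈
  arc-target (inj₂ (inj₁ (_ , j∈ , _))) = j∈
  arc-target (inj₂ (inj₂ (_ , j∈ , _))) = j∈

  h≤N : h ≤ N
  h≤N = m≤m+n h h

  module CrossArc {U V : ℕ} (UV : Cross U V) where

    x p y q : ℕ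
    x = col U
    p = row U
    y = col V
    q = row V

    x<h : x < h
    x<h = proj₁ (proj₂ (proj₂ UV))

    h≤y : h ≤ y
    h≤y = proj₁ (proj₂ (proj₂ (proj₂ UV)))

    x<N : x < N
    x<N = <-≤-trans x<h h≤N

    y<N : y < N
    y<N = col<N V

    p<β : p < β
    p<β = row< (proj₁ UV)

    q<β : q < β
    q<β = row< (proj₁ (proj₂ UV))

    row-complement : ∀ {r} → suc (p + r) ≡ β → r ≡ q
    row-complement {r} eq = +-cancelˡ-≡ p r q (suc-injective (trans eq (sym (proj₂ (proj₂ (proj₂ (proj₂ UV)))))))

    Cut : Rel ℕ 0ℓ
    Cut i j = (i ≡ U × j ≡ U + N) ⊎ (i ≡ V + N × j ≡ V)

    Kept : Rel ℕ 0ℓ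
    Kept i j = Arc i j × ¬ Cut i j

    cut-vertical : ∀ {i j} → Cut i j → col i ≡ col j
    cut-vertical (inj₁ (refl , refl)) = sym (col-+N U)
    cut-vertical (inj₂ (refl , refl)) = col-+N V

    down-path : ∀ e → e ≤ p → Star Kept x (x + e * N)
    down-path zero    _   = subst (Star Kept x) (sym (+-identityʳ x)) ε
    down-path (suc e) e<p = down-path e (<⇒≤ e<p) ◅◅ (inj₁ down , ¬cut) ◅ ε
      where
      down : Down (x + e * N) (x + suc e * N)
      down = cell< x<N (<-≤-trans e<p (<⇒≤ p<β)) , cell< x<N (≤-<-trans e<p p<β) ,
             subst (_< h) (sym (col-cell e x<N)) x<h , cell-suc x e
      ¬cut : ¬ Cut (x + e * N) (x + suc e * N)
      ¬cut (inj₁ (i≡U , _)) = <⇒≢ e<p (trans (sym (row-cell e x<N)) (cong row i≡U))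
      ¬cut (inj₂ (_ , j≡V)) = <⇒≱ x<h (subst (h ≤_) (trans (cong col (sym j≡V)) (col-cell (suc e) x<N)) h≤y)

    up-path : ∀ e → e ≤ q → Star Kept (y + e * N) y
    up-path zero    _   = subst (λ i → Star Kept i y) (sym (+-identityʳ y)) ε
    up-path (suc e) e<q = (inj₂ (inj₁ up) , ¬cut) ◅ up-path e (<⇒≤ e<q)
      where
      up : Up (y + suc e * N) (y + e * N)
      up = cell< y<N (≤-<-trans e<q q<β) , cell< y<N (<-≤-trans e<q (<⇒≤ q<β)) ,
           subst (h ≤_) (sym (col-cell (suc e) y<N)) h≤y , cell-suc y e
      ¬cut : ¬ Cut (y + suc e * N) (y + e * N)
      ¬cut (inj₁ (i≡U , _)) = <⇒≱ x<h (subst (h ≤_) (trans (sym (col-cell (suc e) y<N)) (cong col i≡U)) h≤y)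
      ¬cut (inj₂ (_ , j≡V)) = <⇒≢ e<q (trans (sym (row-cell e y<N)) (cong row j≡V))

    detour : Star Kept x y
    detour = subst (Star Kept x) (sym (m≡m%n+[m/n]*n U N)) (down-path p ≤-refl)
          ◅◅ (inj₂ (inj₂ UV) , ¬cut)
          ◅  subst (λ i → Star Kept i y) (sym (m≡m%n+[m/n]*n V N)) (up-path q ≤-refl)
      where
      ¬cut : ¬ Cut U V
      ¬cut c = <⇒≱ x<h (subst (h ≤_) (sym (cut-vertical c)) h≤y)

    -- An invariant of the paths from the top of column x that avoid the cut
    -- arcs and the arc U → V; it excludes the top of column y.
    Reached : Pred ℕ 0ℓ
    Reached i = (col i ≡ x × row i ≤ p) ⊎ (h ≤ col i × (col i ≢ y ⊎ β ≤ row i + p))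

    reached-top : Reached x
    reached-top = inj₁ (col-small x<N , subst (_≤ p) (sym (row-small x<N)) z≤n)

    unreached-top : ¬ Reached y
    unreached-top (inj₁ (cy≡x , _))     = <⇒≱ x<h (subst (h ≤_) (trans (sym (col-small y<N)) cy≡x) h≤y)
    unreached-top (inj₂ (_ , inj₁ cy≢y)) = cy≢y (col-small y<N)
    unreached-top (inj₂ (_ , inj₂ β≤))   = <⇒≱ p<β (subst (λ r → β ≤ r + p) (row-small y<N) β≤)

    down-preserves : ∀ {i j} → Down i j → ¬ Cut i j → Reached i → Reached j
    down-preserves (_ , _ , ci<h , _) _ (inj₂ (h≤ci , _)) = ⊥-elim (<⇒≱ ci<h h≤ci)
    down-preserves {i} (_ , _ , _ , refl) ¬cut (inj₁ (ci≡x , ri≤p)) with row i ≟ p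
    ... | yes ri≡p = ⊥-elim (¬cut (inj₁ (i≡U , cong (_+ N) i≡U)))
      where i≡U = cell-injective ci≡x ri≡p
    ... | no ri≢p  = inj₁ (trans (col-+N i) ci≡x , subst (_≤ p) (sym (row-+N i)) (≤∧≢⇒< ri≤p ri≢p))

    up-preserves : ∀ {i j} → Up i j → ¬ Cut i j → Reached i → Reached j
    up-preserves (_ , _ , h≤ci , _) _ (inj₁ (ci≡x , _)) = ⊥-elim (<⇒≱ x<h (subst (h ≤_) ci≡x h≤ci))
    up-preserves {j = j} (_ , _ , h≤ci , refl) ¬cut (inj₂ (_ , far)) with col j ≟ y
    ... | no cj≢y = inj₂ (h≤cj , inj₁ cj≢y)
      where h≤cj = subst (h ≤_) (col-+N j) h≤ci
    ... | yes cj≡y with far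
    ...   | inj₁ ci≢y = ⊥-elim (ci≢y (trans (col-+N j) cj≡y))
    ...   | inj₂ β≤ with β ≤? row j + p
    ...     | yes β≤′ = inj₂ (subst (h ≤_) (col-+N j) h≤ci , inj₂ β≤′)
    ...     | no β≰   = ⊥-elim (¬cut (inj₂ (cong (_+ N) j≡V , j≡V)))
      where
      j≡V : j ≡ V
      j≡V = cell-injective cj≡y (row-complement (trans (cong suc (+-comm p (row j)))
              (≤-antisym (≰⇒> β≰) (subst (β ≤_) (cong (_+ p) (row-+N j)) β≤))))

    cross-preserves : ∀ {i j} → Cross i j → Reached i → Reached j ⊎ (i ≡ U × j ≡ V)
    cross-preserves (_ , _ , ci<h , _) (inj₂ (h≤ci , _)) = ⊥-elim (<⇒≱ ci<h h≤ci)
    cross-preserves {i} {j} (_ , _ , _ , h≤cj , rows) (inj₁ (ci≡x , ri≤p)) with col j ≟ y | row i ≟ p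
    ... | no cj≢y  | _        = inj₁ (inj₂ (h≤cj , inj₁ cj≢y))
    ... | yes cj≡y | yes ri≡p =
      inj₂ (cell-injective ci≡x ri≡p ,
            cell-injective cj≡y (row-complement (trans (cong (λ r → suc (r + row j)) (sym ri≡p)) rows)))
    ... | yes _    | no ri≢p  =
      inj₁ (inj₂ (h≤cj , inj₂ (subst (_≤ row j + p) rows
        (≤-trans (+-monoˡ-≤ (row j) (≤∧≢⇒< ri≤p ri≢p)) (≤-reflexive (+-comm p (row j)))))))

    kept-preserves : ∀ {i j} → Kept i j → Reached i → Reached j ⊎ (i ≡ U × j ≡ V)
    kept-preserves (inj₁ down , ¬cut)        = inj₁ ∘ down-preserves down ¬cut
    kept-preserves (inj₂ (inj₁ up) , ¬cut)   = inj₁ ∘ up-preserves up ¬cut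
    kept-preserves (inj₂ (inj₂ cross) , _)   = cross-preserves cross

  module _ {n} (βN≤n : β * N ≤ n) {u v : Fin n} (uv : Cross (toℕ u) (toℕ v)) where

    open CrossArc uv

    G : Digraph n
    G = arcs

    faults : List (Fin n × Fin n)
    faults = edgeAt G (toℕ u) (toℕ u + N) ++ edgeAt G (toℕ v + N) (toℕ v)

    faults-faultSet : FaultSet 2 G faults
    faults-faultSet =
      subst (_≤ 2) (sym (length-++ (edgeAt G (toℕ u) (toℕ u + N))))
            (+-mono-≤ (length-edgeAt G _ _) (length-edgeAt G _ _)) ,
      ++⁺ (edgeAt-edges G _ _) (edgeAt-edges G _ _)

    ∈-faults⁻ : ∀ {s t} → (s , t) List.∈ faults → Cut (toℕ s) (toℕ t)
    ∈-faults⁻ m with ∈-++⁻ (edgeAt G (toℕ u) (toℕ u + N)) m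
    ... | inj₁ m′ = inj₁ (∈-edgeAt⁻ G m′)
    ... | inj₂ m′ = inj₂ (∈-edgeAt⁻ G m′)

    ∈-faults⁺ : ∀ {s t} → Edge G s t → Cut (toℕ s) (toℕ t) → (s , t) List.∈ faults
    ∈-faults⁺ {s} {t} e (inj₁ (s≡ , t≡)) =
      ∈-++⁺ˡ (subst₂ (λ a b → (s , t) List.∈ edgeAt G a b) s≡ t≡ (∈-edgeAt⁺ G e))
    ∈-faults⁺ {s} {t} e (inj₂ (s≡ , t≡)) =
      ∈-++⁺ʳ (edgeAt G (toℕ u) (toℕ u + N))
             (subst₂ (λ a b → (s , t) List.∈ edgeAt G a b) s≡ t≡ (∈-edgeAt⁺ G e))

    kept-lift : ∀ {s j} → Kept (toℕ s) j → Σ (Fin n) λ t → toℕ t ≡ j × EdgeMinus G faults s t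
    kept-lift {s} {j} (arc , ¬cut) =
      t , t≡j , dec-true (Arc? _ _) (subst (Arc (toℕ s)) (sym t≡j) arc) ,
      λ m → ¬cut (subst (Cut (toℕ s)) t≡j (∈-faults⁻ m))
      where
      t : Fin n
      t = fromℕ< (<-≤-trans (arc-target arc) βN≤n)
      t≡j : toℕ t ≡ j
      t≡j = toℕ-fromℕ< _

    cross-arc-critical : ∀ {S H} → (∀ i → toℕ i < N → i ∈ S) → FTRS 2 G S H → Edge H u v
    cross-arc-critical {S} {H} top⊆S (H⊆G , preserves) =
      Star-escape step (proj₁ (preserves a b (top⊆S a a-top) (top⊆S b b-top) faults faults-faultSet) detourG)
                  (subst Reached (sym a≡x) reached-top) (unreached-top ∘ subst Reached b≡y)
      where
      a : Fin n
      a = fromℕ< (<-≤-trans (cell< {e = 0} x<N (≤-<-trans z≤n p<β)) βN≤n)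
      a≡x : toℕ a ≡ x
      a≡x = trans (toℕ-fromℕ< _) (+-identityʳ x)
      a-top : toℕ a < N
      a-top = subst (_< N) (sym a≡x) x<N
      lifted : Σ (Fin n) λ t → toℕ t ≡ y × Reach G faults a t
      lifted = Star-lift kept-lift (subst (λ i → Star Kept i y) (sym a≡x) detour)
      b : Fin n
      b = proj₁ lifted
      b≡y : toℕ b ≡ y
      b≡y = proj₁ (proj₂ lifted)
      b-top : toℕ b < N
      b-top = subst (_< N) (sym b≡y) y<N
      detourG : Reach G faults a b
      detourG = proj₂ (proj₂ lifted)
      step : ∀ {s t} → EdgeMinus H faults s t → Reached (toℕ s) → Reached (toℕ t) ⊎ Edge H u v
      step {s} {t} (e , ∉) r with kept-preserves (does-true⇒ (Arc? _ _) (H⊆G s t e) , ∉ ∘ ∈-faults⁺ (H⊆G s t e)) r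
      ... | inj₁ r′          = inj₁ r′
      ... | inj₂ (s≡u , t≡v) = inj₂ (subst₂ (Edge H) (toℕ-injective s≡u) (toℕ-injective t≡v) e)

  module _ {n} (βN≤n : β * N ≤ n) where

    open ≤-Reasoning

    cross-row-count : ∀ {z e} → z < h → e < β → h ≤ ∑[ j < n ] bit (does (Cross? (z + e * N) j))
    cross-row-count {z} {e} z<h e<β = begin
      h                                   ≡⟨ trans (∑-const h 1) (*-identityʳ h) ⟨
      ∑[ z′ < h ] 1                        ≤⟨ ∑-mono h (λ z′ z′<h → ≤-reflexive (hit z′ z′<h)) ⟩
      ∑[ z′ < h ] g ((h + z′) + e′ * N)    ≤⟨ ∑-suffix h h (λ z′ → g (z′ + e′ * N)) ⟩
      ∑[ z′ < N ] g (z′ + e′ * N)          ≤⟨ ∑-block g e′<β βN≤n ⟩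
      ∑[ j < n ] g j                      ∎
      where
      g : ℕ → ℕ
      g j = bit (does (Cross? (z + e * N) j))
      e′ : ℕ
      e′ = β ∸ suc e
      rows : suc e + e′ ≡ β
      rows = m+[n∸m]≡n e<β
      e′<β : e′ < β
      e′<β = subst (e′ <_) rows (m<n+m e′ (s≤s z≤n))
      z<N : z < N
      z<N = <-≤-trans z<h h≤N
      cross : ∀ z′ → z′ < h → Cross (z + e * N) ((h + z′) + e′ * N)
      cross z′ z′<h =
        cell< z<N e<β , cell< hz′<N e′<β ,
        subst (_< h) (sym (col-cell e z<N)) z<h ,
        subst (h ≤_) (sym (col-cell e′ hz′<N)) (m≤m+n h z′) ,
        trans (cong₂ (λ a b → suc (a + b)) (row-cell e z<N) (row-cell e′ hz′<N)) rows
        where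
        hz′<N : h + z′ < N
        hz′<N = +-monoʳ-< h z′<h
      hit : ∀ z′ → z′ < h → 1 ≡ g ((h + z′) + e′ * N)
      hit z′ z′<h = cong bit (sym (dec-true (Cross? _ _) (cross z′ z′<h)))

    cross-count : β * (h * h) ≤ ∑[ i < n ] ∑[ j < n ] bit (does (Cross? i j))
    cross-count = begin
      β * (h * h)                            ≡⟨ trans (∑-cong β (λ _ → ∑-const h h)) (∑-const β (h * h)) ⟨
      ∑[ e < β ] ∑[ z < h ] h                ≤⟨ ∑-mono β (λ e e<β → ∑-mono h (λ z z<h → cross-row-count z<h e<β)) ⟩
      ∑[ e < β ] ∑[ z < h ] R (z + e * N)    ≤⟨ ∑-mono β (λ e _ → ∑-monoˡ (λ z → R (z + e * N)) h≤N) ⟩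
      ∑[ e < β ] ∑[ z < N ] R (z + e * N)    ≡⟨ ∑-blocks N β R ⟨
      ∑< (β * N) R                           ≤⟨ ∑-monoˡ R βN≤n ⟩
      ∑< n R                                 ∎
      where
      R : ℕ → ℕ
      R i = ∑[ j < n ] bit (does (Cross? i j))

    ftrs-size : ∀ {S H} → (∀ i → toℕ i < N → i ∈ S) → FTRS 2 arcs S H → β * (h * h) ≤ edgeCount H
    ftrs-size {S} {H} top⊆S ftrs = begin
      β * (h * h)                                      ≤⟨ cross-count ⟩
      ∑[ i < n ] ∑[ j < n ] bit (does (Cross? i j))    ≡⟨ edgeCount-toℕ {n} (λ i j → does (Cross? i j)) ⟨
      edgeCount {n} crossArcs                          ≤⟨ edgeCount-mono crossArcs⊆H ⟩
      edgeCount H                                      ∎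
      where
      crossArcs⊆H : Subgraph crossArcs H
      crossArcs⊆H u v uv = cross-arc-critical βN≤n (does-true⇒ (Cross? _ _) uv) top⊆S ftrs

prefix : ∀ n → ℕ → Subset n
prefix n       zero    = ⊥
prefix zero    (suc r) = []
prefix (suc n) (suc r) = inside ∷ prefix n r

∣prefix∣ : ∀ {n r} → r ≤ n → ∣ prefix n r ∣ ≡ r
∣prefix∣ {n}     {zero}  _         = ∣⊥∣≡0 n
∣prefix∣ {suc n} {suc r} (s≤s r≤n) = cong suc (∣prefix∣ r≤n)

∈-prefix : ∀ {n r} (i : Fin n) → toℕ i < r → i ∈ prefix n r
∈-prefix {suc n} {suc r} Fin.zero    _         = here
∈-prefix {suc n} {suc r} (Fin.suc i) (s≤s i<r) = there (∈-prefix i i<r)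

half-bounds : ∀ r′ → let h = suc (r′ / 2) in h + h ≤ suc (suc r′) × suc (suc r′) ≤ 3 * h
half-bounds r′ = double≤ , triple≥
  where
  open ≤-Reasoning
  k : ℕ
  k = r′ / 2
  double≤ : suc k + suc k ≤ suc (suc r′)
  double≤ = s≤s (subst (_≤ suc r′) (sym (+-suc k k))
              (s≤s (subst (_≤ r′) (trans (*-comm k 2) (cong (k +_) (+-identityʳ k))) (m/n*n≤m r′ 2))))
  triple-identity : ∀ m → 2 + (1 + m * 2) + m ≡ 3 * suc m
  triple-identity = solve-∀
  triple≥ : suc (suc r′) ≤ 3 * suc k
  triple≥ = begin
    2 + r′                ≡⟨ cong (2 +_) (m≡m%n+[m/n]*n r′ 2) ⟩
    2 + (r′ % 2 + k * 2)  ≤⟨ +-monoʳ-≤ 2 (+-monoˡ-≤ (k * 2) (s≤s⁻¹ (m%n<n r′ 2))) ⟩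
    2 + (1 + k * 2)       ≤⟨ m≤m+n _ k ⟩
    2 + (1 + k * 2) + k   ≡⟨ triple-identity k ⟩
    3 * suc k             ∎

3h*2β2h≡12βhh : ∀ h β → 3 * h * (2 * (β * (h + h))) ≡ 12 * (β * (h * h))
3h*2β2h≡12βhh = solve-∀

ftrs-lower-bound : ∀ n r → 2 ≤ r → r ≤ n →
                   Σ (Digraph n) λ G → Σ (Subset n) λ S → ∣ S ∣ ≡ r ×
                     (∀ H → FTRS 2 G S H → r * n ≤ 12 * edgeCount H)
ftrs-lower-bound n r@(suc (suc r′)) (s≤s (s≤s _)) r≤n = arcs , prefix n r , ∣prefix∣ r≤n , λ H ftrs → begin
  r * n                      ≤⟨ *-mono-≤ (proj₂ (half-bounds r′)) n≤2βN ⟩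
  3 * h * (2 * (β * N))      ≡⟨ 3h*2β2h≡12βhh h β ⟩
  12 * (β * (h * h))         ≤⟨ *-monoʳ-≤ 12 (ftrs-size βN≤n top⊆S ftrs) ⟩
  12 * edgeCount H           ∎
  where
  open ≤-Reasoning
  β : ℕ
  β = n / (suc (r′ / 2) + suc (r′ / 2))
  open Construction (r′ / 2) β
  N≤r : N ≤ r
  N≤r = proj₁ (half-bounds r′)
  top⊆S : ∀ i → toℕ i < N → i ∈ prefix n r
  top⊆S i i<N = ∈-prefix i (<-≤-trans i<N N≤r)
  βN≤n : β * N ≤ n
  βN≤n = m/n*n≤m n N
  n≤2βN : n ≤ 2 * (β * N)
  n≤2βN = begin
    n               ≡⟨ m≡m%n+[m/n]*n n N ⟩
    n % N + β * N   ≤⟨ +-monoˡ-≤ (β * N) (<⇒≤ (m%n<n n N)) ⟩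
    N + β * N       ≤⟨ +-monoˡ-≤ (β * N) N≤βN ⟩
    β * N + β * N   ≡⟨ cong (β * N +_) (+-identityʳ (β * N)) ⟨
    2 * (β * N)     ∎
    where
    N≤βN : N ≤ β * N
    N≤βN = subst (_≤ β * N) (+-identityʳ N) (*-monoˡ-≤ N (m≥n⇒m/n>0 (≤-trans N≤r r≤n)))

theorem8p1 : ∃[ c ] (∀ n r → 2 ≤ r → r ≤ n →
                 Σ (Digraph n) λ G → Σ (Subset n) λ S → ∣ S ∣ ≡ r ×
                   (∀ H → FTRS 2 G S H → r * n ≤ c * edgeCount H))
theorem8p1 = 12 , ftrs-lower-bound
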